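{- Let $q$ be a prime, let $k \leq q/2$ be a positive integer, and let $T, U$ be multisets over $\mathbb{F}_q$ with total cardinality $|T| + |U| < 2k$. Suppose that $p_i(T) = p_i(U)$ for all $i \in \{0, 1, \ldots, k-1\}$. Then $T = U$ (as multisets).
   Context: For a multiset $X$ of elements of a field and a non-negative integer $i$, the $i$th power sum is $p_i(X) := \sum_{x \in X} x^i$ (summing with multiplicity), with the convention $0^0 := 1$; in particular $p_0(X) = |X|$ (as a field element). -}

module Defs where

open import Data.Nat using (ℕ; _^_)
open import Data.Nat.DivMod using (_mod_)
open import Data.Nat.Primality using (Prime; prime⇒nonZero)
open import Data.Fin using (Fin; toℕ)
open import Data.List using (List; map)
open import Data.Nat.ListAction using (sum)

-- The prime field F_q is modelled as Fin q (residues 0..q-1 = ℤ/qℤ).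
-- A multiset over F_q is a List (Fin q), taken up to permutation (_↭_).
-- i-th power sum p_i(X) = Σ_{x ∈ X} x^i computed in F_q: the natural-number
-- sum of (toℕ x)^i reduced mod q.  Note 0 ^ 0 = 1 in ℕ, matching the
-- convention 0^0 := 1, so p_0(X) = |X| mod q.
powerSum : ∀ {q} → Prime q → ℕ → List (Fin q) → Fin q
powerSum {q} pr i X = _mod_ (sum (map (λ x → toℕ x ^ i) X)) q {{prime⇒nonZero pr}}

-- Let n = |T| = |U| (the lengths agree because p₀ counts elements and both are below q).
-- Newton's identities  j e_j = Σ_{i=1}^{j} (-1)^(i-1) e_{j-i} p_i  determine the elementary
-- symmetric polynomials e_1, …, e_n from p_1, …, p_n, because the factors j ≤ n < q are
-- invertible modulo q.  The e_j are the coefficients of ∏_{t ∈ T} (z - t), so T and U have the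
-- same characteristic polynomial over F_q; every element of T is a root of it, hence occurs in
-- U, and cancelling one linear factor at a time matches T with U.
module Submission where

open import Data.Nat as ℕ using (ℕ; zero; suc; z≤n; s≤s)
import Data.Nat.Properties as ℕ
open import Data.Integer using (ℤ; +_; 0ℤ; 1ℤ)
open import Data.List using (List; []; _∷_; [_]; _++_; length; map)
open import Data.Nat.Primality using (Prime)
open import Defs using (powerSum)
open import Function using (_∘_)
open import Relation.Binary.PropositionalEquality
  using (_≡_; refl; sym; trans; cong; cong₂; subst; subst₂; module ≡-Reasoning)

module Sequences where
  open import Data.Integer using (_+_; _*_)
  open import Data.Integer.Properties using (*-zeroʳ; *-distribˡ-+)
  open import Data.Integer.Tactic.RingSolver using (solve-∀)
  open ≡-Reasoning

  infixl 7 _⋆_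

  -- (f ⋆ g) j = Σ_{l + i = j} f l * g i
  _⋆_ : (ℕ → ℤ) → (ℕ → ℤ) → ℕ → ℤ
  (f ⋆ g) zero    = f 0 * g 0
  (f ⋆ g) (suc j) = f (suc j) * g 0 + (f ⋆ (g ∘ suc)) j

  ⋆-zeroʳ : ∀ f j → (f ⋆ (λ _ → 0ℤ)) j ≡ 0ℤ
  ⋆-zeroʳ f zero    = *-zeroʳ (f 0)
  ⋆-zeroʳ f (suc j) = cong₂ _+_ (*-zeroʳ (f (suc j))) (⋆-zeroʳ f j)

  ⋆-distribˡ-+ : ∀ f g h j → (f ⋆ (λ i → g i + h i)) j ≡ (f ⋆ g) j + (f ⋆ h) j
  ⋆-distribˡ-+ f g h zero    = *-distribˡ-+ (f 0) (g 0) (h 0)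
  ⋆-distribˡ-+ f g h (suc j) = begin
    f (suc j) * (g 0 + h 0) + (f ⋆ (λ i → g (suc i) + h (suc i))) j
      ≡⟨ cong (λ s → f (suc j) * (g 0 + h 0) + s) (⋆-distribˡ-+ f (g ∘ suc) (h ∘ suc) j) ⟩
    f (suc j) * (g 0 + h 0) + ((f ⋆ (g ∘ suc)) j + (f ⋆ (h ∘ suc)) j)
      ≡⟨ regroup (f (suc j)) (g 0) (h 0) _ _ ⟩
    (f ⋆ g) (suc j) + (f ⋆ h) (suc j) ∎
    where
    regroup : ∀ a b c s t → a * (b + c) + (s + t) ≡ (a * b + s) + (a * c + t)
    regroup = solve-∀

  ⋆-*ʳ : ∀ f g x j → (f ⋆ (λ i → x * g i)) j ≡ x * (f ⋆ g) j
  ⋆-*ʳ f g x zero    = commute (f 0) x (g 0)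
    where
    commute : ∀ a x b → a * (x * b) ≡ x * (a * b)
    commute = solve-∀
  ⋆-*ʳ f g x (suc j) = begin
    f (suc j) * (x * g 0) + (f ⋆ (λ i → x * g (suc i))) j
      ≡⟨ cong (λ s → f (suc j) * (x * g 0) + s) (⋆-*ʳ f (g ∘ suc) x j) ⟩
    f (suc j) * (x * g 0) + x * (f ⋆ (g ∘ suc)) j
      ≡⟨ pull-out (f (suc j)) x (g 0) _ ⟩
    x * (f ⋆ g) (suc j) ∎
    where
    pull-out : ∀ a x b s → a * (x * b) + x * s ≡ x * (a * b + s)
    pull-out = solve-∀

  -- horner f c n = Σ_{j ≤ n} f j * c ^ (n - j)
  horner : (ℕ → ℤ) → ℤ → ℕ → ℤ
  horner f c zero    = f 0
  horner f c (suc n) = c * horner f c n + f (suc n)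

open Sequences

module SymmetricFunctions {a} {A : Set a} (ι : A → ℤ) where
  open import Data.Integer using (_+_; _*_; _-_; _^_)
  open import Data.Integer.Properties using (*-zeroʳ)
  open import Data.Integer.Tactic.RingSolver using (solve-∀)
  open import Data.List.Relation.Binary.Permutation.Propositional as ↭ using (_↭_)
  open ≡-Reasoning

  -- e X j is the coefficient of z ^ j in ∏_{x ∈ X} (1 - ι x z), i.e. (-1) ^ j times the
  -- j-th elementary symmetric polynomial of the values ι x.
  e : List A → ℕ → ℤ
  e X       zero    = 1ℤ
  e []      (suc j) = 0ℤ
  e (x ∷ X) (suc j) = e X (suc j) - ι x * e X j

  p : List A → ℕ → ℤ
  p []      i = 0ℤ
  p (x ∷ X) i = ι x ^ i + p X i

  e-vanishes : ∀ X {j} → length X ℕ.< j → e X j ≡ 0ℤ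
  e-vanishes []      {suc j} _           = refl
  e-vanishes (x ∷ X) {suc j} (s≤s |X|<j) = begin
    e X (suc j) - ι x * e X j
      ≡⟨ cong₂ (λ u v → u - ι x * v) (e-vanishes X (ℕ.m≤n⇒m≤1+n |X|<j)) (e-vanishes X |X|<j) ⟩
    0ℤ - ι x * 0ℤ
      ≡⟨ cong (λ v → 0ℤ - v) (*-zeroʳ (ι x)) ⟩
    0ℤ ∎

  e-∷-cong : ∀ x {X Y} → (∀ j → e X j ≡ e Y j) → ∀ j → e (x ∷ X) j ≡ e (x ∷ Y) j
  e-∷-cong x X≡Y zero    = refl
  e-∷-cong x X≡Y (suc j) = cong₂ (λ u v → u - ι x * v) (X≡Y (suc j)) (X≡Y j)

  e-swap : ∀ x y Z j → e (x ∷ y ∷ Z) j ≡ e (y ∷ x ∷ Z) j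
  e-swap x y Z zero          = refl
  e-swap x y Z (suc zero)    = swap-linear (e Z 1) (ι x) (ι y)
    where
    swap-linear : ∀ u x y → (u - y * 1ℤ) - x * 1ℤ ≡ (u - x * 1ℤ) - y * 1ℤ
    swap-linear = solve-∀
  e-swap x y Z (suc (suc j)) = swap-quadratic (e Z (suc (suc j))) (e Z (suc j)) (e Z j) (ι x) (ι y)
    where
    swap-quadratic : ∀ u v w x y → (u - y * v) - x * (v - y * w) ≡ (u - x * v) - y * (v - x * w)
    swap-quadratic = solve-∀

  e-↭ : ∀ {X Y} → X ↭ Y → ∀ j → e X j ≡ e Y j
  e-↭ ↭.refl            j = refl
  e-↭ (↭.prep x X↭Y)    j = e-∷-cong x (e-↭ X↭Y) j
  e-↭ (↭.swap x y X↭Y)  j = trans (e-∷-cong x (e-∷-cong y (e-↭ X↭Y)) j) (e-swap x y _ j)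
  e-↭ (↭.trans X↭Y Y↭Z) j = trans (e-↭ X↭Y j) (e-↭ Y↭Z j)

  ⋆-e-∷ : ∀ x X g j → (e (x ∷ X) ⋆ g) (suc j) ≡ (e X ⋆ g) (suc j) - ι x * (e X ⋆ g) j
  ⋆-e-∷ x X g zero    = expand (e X 1) (ι x) (g 0) (g 1)
    where
    expand : ∀ u x g₀ g₁ → (u - x * 1ℤ) * g₀ + 1ℤ * g₁ ≡ (u * g₀ + 1ℤ * g₁) - x * (1ℤ * g₀)
    expand = solve-∀
  ⋆-e-∷ x X g (suc j) = begin
    (e X (suc (suc j)) - ι x * e X (suc j)) * g 0 + (e (x ∷ X) ⋆ (g ∘ suc)) (suc j)
      ≡⟨ cong (λ s → (e X (suc (suc j)) - ι x * e X (suc j)) * g 0 + s) (⋆-e-∷ x X (g ∘ suc) j) ⟩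
    (e X (suc (suc j)) - ι x * e X (suc j)) * g 0 + ((e X ⋆ (g ∘ suc)) (suc j) - ι x * (e X ⋆ (g ∘ suc)) j)
      ≡⟨ expand (e X (suc (suc j))) (e X (suc j)) (ι x) (g 0) _ _ ⟩
    (e X ⋆ g) (suc (suc j)) - ι x * (e X ⋆ g) (suc j) ∎
    where
    expand : ∀ u v x g₀ s t → (u - x * v) * g₀ + (s - x * t) ≡ (u * g₀ + s) - x * (v * g₀ + t)
    expand = solve-∀

  -- As power series e (x ∷ X) = (1 - ι x z) · e X, and Σ (ι x z) ^ i inverts 1 - ι x z.
  ⋆-e-∷-powers : ∀ x X j → (e (x ∷ X) ⋆ (ι x ^_)) j ≡ e X j
  ⋆-e-∷-powers x X zero    = refl
  ⋆-e-∷-powers x X (suc j) = begin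
    (e (x ∷ X) ⋆ (ι x ^_)) (suc j)
      ≡⟨ ⋆-e-∷ x X (ι x ^_) j ⟩
    (e X (suc j) * 1ℤ + (e X ⋆ (λ i → ι x * ι x ^ i)) j) - ι x * (e X ⋆ (ι x ^_)) j
      ≡⟨ cong (λ s → (e X (suc j) * 1ℤ + s) - ι x * (e X ⋆ (ι x ^_)) j) (⋆-*ʳ (e X) (ι x ^_) (ι x) j) ⟩
    (e X (suc j) * 1ℤ + ι x * (e X ⋆ (ι x ^_)) j) - ι x * (e X ⋆ (ι x ^_)) j
      ≡⟨ cancel (e X (suc j)) (ι x * (e X ⋆ (ι x ^_)) j) ⟩
    e X (suc j) ∎
    where
    cancel : ∀ u s → (u * 1ℤ + s) - s ≡ u
    cancel = solve-∀

  newton : ∀ X j → + suc j * e X (suc j) + (e X ⋆ (p X ∘ suc)) j ≡ 0ℤ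
  newton []      j    = cong₂ _+_ (*-zeroʳ (+ suc j)) (⋆-zeroʳ (e []) j)
  newton (x ∷ X) zero = trans (expand (e X 1) (ι x) (p X 1)) (newton X zero)
    where
    expand : ∀ u x s → + 1 * (u - x * 1ℤ) + 1ℤ * (x * 1ℤ + s) ≡ + 1 * u + 1ℤ * s
    expand = solve-∀
  newton (x ∷ X) (suc j) = begin
    + suc (suc j) * e′ (suc (suc j)) + (e′ ⋆ (p (x ∷ X) ∘ suc)) (suc j)
      ≡⟨ cong (λ s → + suc (suc j) * e′ (suc (suc j)) + s) power-sums-split ⟩
    + suc (suc j) * (e X (suc (suc j)) - ι x * e X (suc j)) + (ι x * e X (suc j) + (S (suc j) - ι x * S j))
      ≡⟨ regroup (+ suc j) (e X (suc (suc j))) (e X (suc j)) (ι x) (S (suc j)) (S j) ⟩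
    (+ suc (suc j) * e X (suc (suc j)) + S (suc j)) - ι x * (+ suc j * e X (suc j) + S j)
      ≡⟨ cong₂ (λ s t → s - ι x * t) (newton X (suc j)) (newton X j) ⟩
    0ℤ - ι x * 0ℤ
      ≡⟨ cong (λ v → 0ℤ - v) (*-zeroʳ (ι x)) ⟩
    0ℤ ∎
    where
    e′ : ℕ → ℤ
    e′ = e (x ∷ X)
    S : ℕ → ℤ
    S = e X ⋆ (p X ∘ suc)
    power-sums-split : (e′ ⋆ (p (x ∷ X) ∘ suc)) (suc j) ≡ ι x * e X (suc j) + (S (suc j) - ι x * S j)
    power-sums-split = begin
      (e′ ⋆ (λ i → ι x * ι x ^ i + p X (suc i))) (suc j)
        ≡⟨ ⋆-distribˡ-+ e′ (λ i → ι x * ι x ^ i) (p X ∘ suc) (suc j) ⟩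
      (e′ ⋆ (λ i → ι x * ι x ^ i)) (suc j) + (e′ ⋆ (p X ∘ suc)) (suc j)
        ≡⟨ cong₂ _+_ (trans (⋆-*ʳ e′ (ι x ^_) (ι x) (suc j)) (cong (ι x *_) (⋆-e-∷-powers x X (suc j))))
                     (⋆-e-∷ x X (p X ∘ suc) j) ⟩
      ι x * e X (suc j) + (S (suc j) - ι x * S j) ∎
    regroup : ∀ n u v x s t →
      (1ℤ + n) * (u - x * v) + (x * v + (s - x * t)) ≡ ((1ℤ + n) * u + s) - x * (n * v + t)
    regroup = solve-∀

  horner-e-∷-step : ∀ x X c j →
    horner (e (x ∷ X)) c (suc j) ≡ horner (e X) c (suc j) - ι x * horner (e X) c j
  horner-e-∷-step x X c zero    = expand c (e X 1) (ι x)
    where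
    expand : ∀ c u x → c * 1ℤ + (u - x * 1ℤ) ≡ (c * 1ℤ + u) - x * 1ℤ
    expand = solve-∀
  horner-e-∷-step x X c (suc j) = begin
    c * horner (e (x ∷ X)) c (suc j) + e (x ∷ X) (suc (suc j))
      ≡⟨ cong (λ h → c * h + e (x ∷ X) (suc (suc j))) (horner-e-∷-step x X c j) ⟩
    c * (horner (e X) c (suc j) - ι x * horner (e X) c j) + (e X (suc (suc j)) - ι x * e X (suc j))
      ≡⟨ expand c (horner (e X) c (suc j)) (horner (e X) c j) (e X (suc (suc j))) (e X (suc j)) (ι x) ⟩
    horner (e X) c (suc (suc j)) - ι x * horner (e X) c (suc j) ∎
    where
    expand : ∀ c h g u v x → c * (h - x * g) + (u - x * v) ≡ (c * h + u) - x * (c * g + v)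
    expand = solve-∀

  horner-e-∷ : ∀ x X c → horner (e (x ∷ X)) c (length (x ∷ X)) ≡ (c - ι x) * horner (e X) c (length X)
  horner-e-∷ x X c = begin
    horner (e (x ∷ X)) c (suc n)
      ≡⟨ horner-e-∷-step x X c n ⟩
    (c * H + e X (suc n)) - ι x * H
      ≡⟨ cong (λ t → (c * H + t) - ι x * H) (e-vanishes X (ℕ.n<1+n n)) ⟩
    (c * H + 0ℤ) - ι x * H
      ≡⟨ factor c H (ι x) ⟩
    (c - ι x) * H ∎
    where
    n : ℕ
    n = length X
    H : ℤ
    H = horner (e X) c n
    factor : ∀ c h x → (c * h + 0ℤ) - x * h ≡ (c - x) * h
    factor = solve-∀

module Congruence (q : ℕ) where
  open import Data.Integer using (_+_; _*_; _-_; -_; ∣_∣)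
  open import Data.Integer.Divisibility.Signed
    using (_∣_; divides; ∣⇒∣ᵤ; ∣m∣n⇒∣m+n; ∣m⇒∣-m; ∣n⇒∣m*n; ∣m⇒∣m*n)
  open import Data.Integer.Properties
    using (+-inverseʳ; +-identityʳ; +-injective; i-j≡0⇒i≡j; ∣i∣≡0⇒i≡0; [+m]-[+n]≡m⊖n; ∣m⊝n∣≤m⊔n)
  open import Data.Integer.Tactic.RingSolver using (solve-∀)
  open import Data.Empty using (⊥-elim)
  open import Data.Nat.Divisibility using (>⇒∤) renaming (_∣_ to _∣ℕ_)
  open import Relation.Binary.Bundles using (Setoid)

  infix 4 _≈_
  record _≈_ (a b : ℤ) : Set where
    constructor congruent
    field q∣a-b : + q ∣ a - b

  ≡⇒≈ : ∀ {a b} → a ≡ b → a ≈ b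
  ≡⇒≈ {a} refl = congruent (divides 0ℤ (+-inverseʳ a))

  ≈-refl : ∀ {a} → a ≈ a
  ≈-refl = ≡⇒≈ refl

  ≈-sym : ∀ {a b} → a ≈ b → b ≈ a
  ≈-sym {a} {b} (congruent q∣a-b) = congruent (subst (+ q ∣_) (negate a b) (∣m⇒∣-m q∣a-b))
    where
    negate : ∀ a b → - (a - b) ≡ b - a
    negate = solve-∀

  ≈-trans : ∀ {a b c} → a ≈ b → b ≈ c → a ≈ c
  ≈-trans {a} {b} {c} (congruent q∣a-b) (congruent q∣b-c) =
    congruent (subst (+ q ∣_) (telescope a b c) (∣m∣n⇒∣m+n q∣a-b q∣b-c))
    where
    telescope : ∀ a b c → (a - b) + (b - c) ≡ a - c
    telescope = solve-∀

  ≈-setoid : Setoid _ _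
  ≈-setoid = record
    { Carrier       = ℤ
    ; _≈_           = _≈_
    ; isEquivalence = record { refl = ≈-refl ; sym = ≈-sym ; trans = ≈-trans }
    }

  +-cong : ∀ {a a′ b b′} → a ≈ a′ → b ≈ b′ → a + b ≈ a′ + b′
  +-cong {a} {a′} {b} {b′} (congruent q∣a-a′) (congruent q∣b-b′) =
    congruent (subst (+ q ∣_) (regroup a a′ b b′) (∣m∣n⇒∣m+n q∣a-a′ q∣b-b′))
    where
    regroup : ∀ a a′ b b′ → (a - a′) + (b - b′) ≡ (a + b) - (a′ + b′)
    regroup = solve-∀

  -‿cong : ∀ {a a′} → a ≈ a′ → - a ≈ - a′
  -‿cong {a} {a′} (congruent q∣a-a′) = congruent (subst (+ q ∣_) (negate a a′) (∣m⇒∣-m q∣a-a′))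
    where
    negate : ∀ a a′ → - (a - a′) ≡ - a - - a′
    negate = solve-∀

  *-cong : ∀ {a a′ b b′} → a ≈ a′ → b ≈ b′ → a * b ≈ a′ * b′
  *-cong {a} {a′} {b} {b′} (congruent q∣a-a′) (congruent q∣b-b′) =
    congruent (subst (+ q ∣_) (regroup a a′ b b′)
                     (∣m∣n⇒∣m+n (∣n⇒∣m*n a q∣b-b′) (∣m⇒∣m*n b′ q∣a-a′)))
    where
    regroup : ∀ a a′ b b′ → a * (b - b′) + (a - a′) * b′ ≡ a * b - a′ * b′
    regroup = solve-∀

  ≈0⇒∣ : ∀ {a} → a ≈ 0ℤ → + q ∣ a
  ≈0⇒∣ {a} (congruent q∣a-0) = subst (+ q ∣_) (+-identityʳ a) q∣a-0

  ∣⇒≈0 : ∀ {a} → + q ∣ a → a ≈ 0ℤ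
  ∣⇒≈0 {a} q∣a = congruent (subst (+ q ∣_) (sym (+-identityʳ a)) q∣a)

  i-j≈0⇒i≈j : ∀ {a b} → a - b ≈ 0ℤ → a ≈ b
  i-j≈0⇒i≈j a-b≈0 = congruent (≈0⇒∣ a-b≈0)

  <q∧q∣⇒≡0 : ∀ {d} → d ℕ.< q → q ∣ℕ d → d ≡ 0
  <q∧q∣⇒≡0 {zero}  _   _   = refl
  <q∧q∣⇒≡0 {suc _} d<q q∣d = ⊥-elim (>⇒∤ d<q q∣d)

  +-injective-mod : ∀ {m n} → m ℕ.< q → n ℕ.< q → + m ≈ + n → m ≡ n
  +-injective-mod {m} {n} m<q n<q (congruent q∣m-n) =
    +-injective (i-j≡0⇒i≡j (+ m) (+ n) (∣i∣≡0⇒i≡0 (<q∧q∣⇒≡0 ∣m-n∣<q (∣⇒∣ᵤ q∣m-n))))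
    where
    ∣m-n∣<q : ∣ + m - + n ∣ ℕ.< q
    ∣m-n∣<q = ℕ.≤-<-trans
      (subst (ℕ._≤ m ℕ.⊔ n) (cong ∣_∣ (sym ([+m]-[+n]≡m⊖n m n))) (∣m⊝n∣≤m⊔n m n))
      (ℕ.⊔-pres-<m m<q n<q)

  ⋆-cong : ∀ {f f′ g g′} j → (∀ l → l ℕ.≤ j → f l ≈ f′ l) → (∀ i → i ℕ.≤ j → g i ≈ g′ i) →
           (f ⋆ g) j ≈ (f′ ⋆ g′) j
  ⋆-cong zero    f≈f′ g≈g′ = *-cong (f≈f′ 0 z≤n) (g≈g′ 0 z≤n)
  ⋆-cong (suc j) f≈f′ g≈g′ = +-cong (*-cong (f≈f′ (suc j) ℕ.≤-refl) (g≈g′ 0 z≤n))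
    (⋆-cong j (λ l l≤j → f≈f′ l (ℕ.m≤n⇒m≤1+n l≤j)) (λ i i≤j → g≈g′ (suc i) (s≤s i≤j)))

  horner-cong : ∀ {f g} c n → (∀ j → f j ≈ g j) → horner f c n ≈ horner g c n
  horner-cong c zero    f≈g = f≈g 0
  horner-cong c (suc n) f≈g = +-cong (*-cong (≈-refl {c}) (horner-cong c n f≈g)) (f≈g (suc n))

module PrimeModulus {q : ℕ} (pr : Prime q) where
  open import Data.Integer using (_*_; _-_; ∣_∣)
  open import Data.Integer.Divisibility.Signed using (_∣_; ∣⇒∣ᵤ; ∣ᵤ⇒∣)
  open import Data.Integer.Properties using (abs-*)
  open import Data.Integer.Tactic.RingSolver using (solve-∀)
  open import Data.Empty using (⊥-elim)
  open import Data.Nat.Base using (nonTrivial⇒≢1)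
  open import Data.Nat.Divisibility using (>⇒∤; ∣1⇒≡1) renaming (_∣_ to _∣ℕ_)
  open import Data.Nat.Primality using (euclidsLemma; prime⇒nonTrivial)
  open import Data.Sum using (_⊎_; [_,_]′) renaming (map to ⊎-map)
  open import Relation.Nullary using (¬_)
  open Congruence q

  ∣-euclid : ∀ a b → + q ∣ a * b → (+ q ∣ a) ⊎ (+ q ∣ b)
  ∣-euclid a b q∣ab =
    ⊎-map ∣ᵤ⇒∣ ∣ᵤ⇒∣ (euclidsLemma ∣ a ∣ ∣ b ∣ pr (subst (q ∣ℕ_) (abs-* a b) (∣⇒∣ᵤ q∣ab)))

  no-zero-divisors : ∀ {a b} → a * b ≈ 0ℤ → a ≈ 0ℤ ⊎ b ≈ 0ℤ
  no-zero-divisors {a} {b} ab≈0 = ⊎-map ∣⇒≈0 ∣⇒≈0 (∣-euclid a b (≈0⇒∣ ab≈0))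

  1≉0 : ¬ (1ℤ ≈ 0ℤ)
  1≉0 1≈0 = nonTrivial⇒≢1 {{prime⇒nonTrivial pr}} (∣1⇒≡1 (∣⇒∣ᵤ (≈0⇒∣ 1≈0)))

  *-cancelˡ-≈ : ∀ {j a b} → suc j ℕ.< q → + suc j * a ≈ + suc j * b → a ≈ b
  *-cancelˡ-≈ {j} {a} {b} 1+j<q (congruent q∣ja-jb) =
    [ (λ q∣1+j → ⊥-elim (>⇒∤ 1+j<q (∣⇒∣ᵤ q∣1+j))) , congruent ]′
      (∣-euclid (+ suc j) (a - b) (subst (+ q ∣_) (factor (+ suc j) a b) q∣ja-jb))
    where
    factor : ∀ n a b → n * a - n * b ≡ n * (a - b)
    factor = solve-∀

module Recovery {q : ℕ} (pr : Prime q) {a} {A : Set a} (ι : A → ℤ) where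
  open import Data.Integer using (_+_; _*_; _-_; -_)
  open import Data.Integer.Properties using (+-0-abelianGroup; +-inverseʳ)
  open import Data.Integer.Tactic.RingSolver using (solve-∀)
  open import Algebra.Properties.AbelianGroup +-0-abelianGroup using (inverseˡ-unique)
  open import Data.Empty using (⊥-elim)
  open import Data.List.Membership.Propositional using (_∈_)
  open import Data.List.Membership.Propositional.Properties using (∈-∃++)
  open import Data.List.Relation.Binary.Permutation.Propositional
    using (_↭_; ↭-refl; ↭-reflexive; ↭-prep; ↭-trans; ↭-sym)
  open import Data.List.Relation.Binary.Permutation.Propositional.Properties using (shift; ↭-length)
  open import Data.List.Relation.Unary.Any as Any using (Any; here; there)
  open import Data.Product using (_,_; ∃₂)
  open import Data.Sum using (inj₁; inj₂; [_,_]′)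
  open import Relation.Nullary using (yes; no)
  open import Relation.Binary.Reasoning.Setoid (Congruence.≈-setoid q)
  open SymmetricFunctions ι
  open Congruence q
  open PrimeModulus pr

  e-∷-cancel : ∀ x {X Y} → (∀ j → e (x ∷ X) j ≈ e (x ∷ Y) j) → ∀ j → e X j ≈ e Y j
  e-∷-cancel x         X≈Y zero    = ≈-refl
  e-∷-cancel x {X} {Y} X≈Y (suc j) = begin
    e X (suc j)
      ≡⟨ restore (e X (suc j)) (ι x * e X j) ⟨
    (e X (suc j) - ι x * e X j) + ι x * e X j
      ≈⟨ +-cong (X≈Y (suc j)) (*-cong (≈-refl {ι x}) (e-∷-cancel x X≈Y j)) ⟩
    (e Y (suc j) - ι x * e Y j) + ι x * e Y j
      ≡⟨ restore (e Y (suc j)) (ι x * e Y j) ⟩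
    e Y (suc j) ∎
    where
    restore : ∀ u v → (u - v) + v ≡ u
    restore = solve-∀

  p≈⇒e≈ : ∀ {X Y} → length X ≡ length Y → length X ℕ.< q →
             (∀ {i} → 1 ℕ.≤ i → i ℕ.≤ length X → p X i ≈ p Y i) → ∀ j → e X j ≈ e Y j
  p≈⇒e≈ {X} {Y} |X|≡|Y| |X|<q same-p j = agree-up-to j j ℕ.≤-refl
    where
    newton-solved : ∀ Z j → + suc j * e Z (suc j) ≡ - (e Z ⋆ (p Z ∘ suc)) j
    newton-solved Z j = inverseˡ-unique _ _ (newton Z j)

    next : ∀ j → (∀ l → l ℕ.≤ j → e X l ≈ e Y l) → e X (suc j) ≈ e Y (suc j)
    next j agree with suc j ℕ.≤? length X
    ... | no  1+j≰|X| = ≡⇒≈ (trans (e-vanishes X |X|<1+j) (sym (e-vanishes Y |Y|<1+j)))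
      where
      |X|<1+j = ℕ.≰⇒> 1+j≰|X|
      |Y|<1+j = subst (ℕ._< suc j) |X|≡|Y| |X|<1+j
    ... | yes 1+j≤|X| = *-cancelˡ-≈ (ℕ.≤-<-trans 1+j≤|X| |X|<q) (begin
      + suc j * e X (suc j)   ≡⟨ newton-solved X j ⟩
      - (e X ⋆ (p X ∘ suc)) j ≈⟨ -‿cong (⋆-cong j agree same-p-up-to) ⟩
      - (e Y ⋆ (p Y ∘ suc)) j ≡⟨ newton-solved Y j ⟨
      + suc j * e Y (suc j)   ∎)
      where
      same-p-up-to : ∀ i → i ℕ.≤ j → p X (suc i) ≈ p Y (suc i)
      same-p-up-to i i≤j = same-p (s≤s z≤n) (ℕ.≤-trans (s≤s i≤j) 1+j≤|X|)

    agree-up-to : ∀ j l → l ℕ.≤ j → e X l ≈ e Y l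
    agree-up-to _       zero    _         = ≈-refl
    agree-up-to (suc j) (suc l) (s≤s l≤j) with ℕ.m≤n⇒m<n∨m≡n l≤j
    ... | inj₁ l<j  = agree-up-to j (suc l) l<j
    ... | inj₂ refl = next l (agree-up-to l)

  horner-root : ∀ c Y → horner (e Y) c (length Y) ≈ 0ℤ → Any (λ y → c - ι y ≈ 0ℤ) Y
  horner-root c []      h = ⊥-elim (1≉0 h)
  horner-root c (y ∷ Y) h = [ here , there ∘ horner-root c Y ]′ (no-zero-divisors {c - ι y} factored≈0)
    where
    factored≈0 : (c - ι y) * horner (e Y) c (length Y) ≈ 0ℤ
    factored≈0 = ≈-trans (≡⇒≈ (sym (horner-e-∷ y Y c))) h

  module _ (ι-injective : ∀ {x y} → ι x ≈ ι y → x ≡ y) where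

    e≈⇒∈ : ∀ x X Y → length Y ≡ length (x ∷ X) → (∀ j → e (x ∷ X) j ≈ e Y j) → x ∈ Y
    e≈⇒∈ x X Y |Y|≡1+|X| same = Any.map (ι-injective ∘ i-j≈0⇒i≈j) (horner-root (ι x) Y root)
      where
      root : horner (e Y) (ι x) (length Y) ≈ 0ℤ
      root = begin
        horner (e Y) (ι x) (length Y)
          ≡⟨ cong (horner (e Y) (ι x)) |Y|≡1+|X| ⟩
        horner (e Y) (ι x) (length (x ∷ X))
          ≈⟨ horner-cong (ι x) (length (x ∷ X)) (λ j → ≈-sym (same j)) ⟩
        horner (e (x ∷ X)) (ι x) (length (x ∷ X))
          ≡⟨ horner-e-∷ x X (ι x) ⟩
        (ι x - ι x) * horner (e X) (ι x) (length X)
          ≡⟨ cong (_* horner (e X) (ι x) (length X)) (+-inverseʳ (ι x)) ⟩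
        0ℤ ∎

    e≈⇒↭ : ∀ X Y → length X ≡ length Y → (∀ j → e X j ≈ e Y j) → X ↭ Y
    e≈⇒↭ []      []      _       _    = ↭-refl
    e≈⇒↭ []      (_ ∷ _) ()      _
    e≈⇒↭ (x ∷ X) Y       |X|≡|Y| same = match (∈-∃++ (e≈⇒∈ x X Y (sym |X|≡|Y|) same))
      where
      match : (∃₂ λ Y₁ Y₂ → Y ≡ Y₁ ++ [ x ] ++ Y₂) → x ∷ X ↭ Y
      match (Y₁ , Y₂ , Y≡Y₁++x∷Y₂) = ↭-trans (↭-prep x (e≈⇒↭ X (Y₁ ++ Y₂) |X|≡|Y′| same′)) (↭-sym Y↭x∷Y′)
        where
        Y↭x∷Y′ : Y ↭ x ∷ Y₁ ++ Y₂
        Y↭x∷Y′ = ↭-trans (↭-reflexive Y≡Y₁++x∷Y₂) (shift x Y₁ Y₂)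
        |X|≡|Y′| : length X ≡ length (Y₁ ++ Y₂)
        |X|≡|Y′| = ℕ.suc-injective (trans |X|≡|Y| (↭-length Y↭x∷Y′))
        same′ : ∀ j → e X j ≈ e (Y₁ ++ Y₂) j
        same′ = e-∷-cancel x (λ j → ≈-trans (same j) (≡⇒≈ (e-↭ Y↭x∷Y′ j)))

module PowerSumsModPrime {q : ℕ} (pr : Prime q) where
  open import Data.Integer using (_+_; _*_; _-_; _^_)
  open import Data.Integer.Properties using (pos-+; pos-*)
  open import Data.Integer.Divisibility.Signed using (divides)
  open import Data.Integer.Tactic.RingSolver using (solve-∀)
  open import Data.Fin using (Fin; toℕ)
  open import Data.Fin.Properties using (toℕ<n; toℕ-injective; toℕ-fromℕ<)
  open import Data.Nat.DivMod using (_mod_; _%_; _/_; m≡m%n+[m/n]*n)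
  open import Data.Nat.ListAction using (sum)
  open import Data.Nat.Primality using (prime⇒nonZero)
  open ≡-Reasoning
  open Congruence q

  private instance
    q≢0 : ℕ.NonZero q
    q≢0 = prime⇒nonZero pr

  ι : Fin q → ℤ
  ι x = + toℕ x

  open SymmetricFunctions ι using (p)

  ι-injective : ∀ {x y} → ι x ≈ ι y → x ≡ y
  ι-injective = toℕ-injective ∘ +-injective-mod (toℕ<n _) (toℕ<n _)

  +m≈+[m%q] : ∀ m → + m ≈ + (m % q)
  +m≈+[m%q] m = congruent (divides (+ (m / q)) (begin
    + m - + r                     ≡⟨ cong (λ n → + n - + r) (m≡m%n+[m/n]*n m q) ⟩
    + (r ℕ.+ m / q ℕ.* q) - + r   ≡⟨ cong (_- + r) (trans (pos-+ r _) (cong (_+_ (+ r)) (pos-* (m / q) q))) ⟩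
    (+ r + + (m / q) * + q) - + r ≡⟨ cancel (+ r) (+ (m / q)) (+ q) ⟩
    + (m / q) * + q               ∎))
    where
    r : ℕ
    r = m % q
    cancel : ∀ r t q → (r + t * q) - r ≡ t * q
    cancel = solve-∀

  mod≡⇒≈ : ∀ m n → m mod q ≡ n mod q → + m ≈ + n
  mod≡⇒≈ m n m≡n = ≈-trans (+m≈+[m%q] m) (≈-trans (≡⇒≈ (cong +_ m%q≡n%q)) (≈-sym (+m≈+[m%q] n)))
    where
    m%q≡n%q : m % q ≡ n % q
    m%q≡n%q = trans (sym (toℕ-fromℕ< _)) (trans (cong toℕ m≡n) (toℕ-fromℕ< _))

  +-^ : ∀ m i → (+ m) ^ i ≡ + (m ℕ.^ i)
  +-^ m zero    = refl
  +-^ m (suc i) = trans (cong (_*_ (+ m)) (+-^ m i)) (sym (pos-* m (m ℕ.^ i)))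

  sumℕ : List (Fin q) → ℕ → ℕ
  sumℕ X i = sum (map (λ x → toℕ x ℕ.^ i) X)

  p-≡-sumℕ : ∀ X i → p X i ≡ + sumℕ X i
  p-≡-sumℕ []      i = refl
  p-≡-sumℕ (x ∷ X) i = trans (cong₂ _+_ (+-^ (toℕ x) i) (p-≡-sumℕ X i)) (sym (pos-+ (toℕ x ℕ.^ i) (sumℕ X i)))

  powerSum≡⇒p≈ : ∀ X Y i → powerSum pr i X ≡ powerSum pr i Y → p X i ≈ p Y i
  powerSum≡⇒p≈ X Y i same =
    ≈-trans (≡⇒≈ (p-≡-sumℕ X i)) (≈-trans (mod≡⇒≈ (sumℕ X i) (sumℕ Y i) same) (≡⇒≈ (sym (p-≡-sumℕ Y i))))

  sumℕ-0 : ∀ X → sumℕ X 0 ≡ length X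
  sumℕ-0 []      = refl
  sumℕ-0 (x ∷ X) = cong suc (sumℕ-0 X)

  powerSum₀≡⇒length≡ : ∀ X Y → powerSum pr 0 X ≡ powerSum pr 0 Y →
                       length X ℕ.< q → length Y ℕ.< q → length X ≡ length Y
  powerSum₀≡⇒length≡ X Y same |X|<q |Y|<q = +-injective-mod |X|<q |Y|<q
    (subst₂ (λ m n → + m ≈ + n) (sumℕ-0 X) (sumℕ-0 Y) (mod≡⇒≈ (sumℕ X 0) (sumℕ Y 0) same))

open import Data.Nat using (_+_; _*_; _≤_; _<_)
open import Data.Fin using (Fin)
open import Data.List.Relation.Binary.Permutation.Propositional using (_↭_)

proposition2p5 : (q : ℕ) (pr : Prime q) (k : ℕ) → 1 ≤ k → 2 * k ≤ q →
    (T U : List (Fin q)) → length T + length U < 2 * k →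
    (∀ i → i < k → powerSum pr i T ≡ powerSum pr i U) →
    T ↭ U
proposition2p5 q pr k 1≤k 2k≤q T U |T|+|U|<2k same-powerSums =
  e≈⇒↭ ι-injective T U |T|≡|U| (p≈⇒e≈ |T|≡|U| |T|<q
    (λ {i} _ i≤|T| → powerSum≡⇒p≈ T U i (same-powerSums i (ℕ.≤-<-trans i≤|T| |T|<k))))
  where
  open PowerSumsModPrime pr
  open Recovery pr ι
  |T|<q : length T < q
  |T|<q = ℕ.<-≤-trans (ℕ.≤-<-trans (ℕ.m≤m+n _ _) |T|+|U|<2k) 2k≤q
  |U|<q : length U < q
  |U|<q = ℕ.<-≤-trans (ℕ.≤-<-trans (ℕ.m≤n+m _ _) |T|+|U|<2k) 2k≤q
  |T|≡|U| : length T ≡ length U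
  |T|≡|U| = powerSum₀≡⇒length≡ T U (same-powerSums 0 1≤k) |T|<q |U|<q
  |T|<k : length T < k
  |T|<k = ℕ.*-cancelˡ-< 2 _ _
    (subst (_< 2 * k) (cong (_+_ (length T)) (trans (sym |T|≡|U|) (sym (ℕ.+-identityʳ _)))) |T|+|U|<2k)
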